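{- There is a constant $c$ such that for every $n\geq1$ and every permutation $\pi$ of $[0,4^n)$, the number of indices $0\leq i<2^n$ for which there exists $s\in[1,4^n]$ with $\rho_s(\pi(X_i))>\frac1n$, where $X_i=[i2^n,(i+1)2^n)$, is at most $c\,n^2$.
   Context: For $B\subseteq\omega$ and $s\geq1$, $\rho_s(B)=\frac{|B\cap\{0,\dots,s-1\}|}{s}$. The sets $X_i=[i2^n,(i+1)2^n)$, $0\leq i<2^n$, are called the sub-blocks of $[0,4^n)$, and $\pi(X_i)$ denotes the image of $X_i$ under $\pi$. -}

module Defs where

open import Data.Nat using (ℕ; zero; suc; _+_; _*_; _^_; _<_; _<?_; _≤_)
open import Data.Nat.Properties using (≤-refl; anyUpTo?)
open import Data.Fin using (Fin; toℕ; fromℕ<)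
open import Data.Product using (Σ; _×_; _,_)
open import Relation.Nullary using (Dec; yes; no)
open import Function.Bundles using (_↔_; Inverse)

count : (m : ℕ) → (P : ℕ → Set) → ((k : ℕ) → Dec (P k)) → ℕ
count zero    P P? = 0
count (suc m) P P? with P? m
... | yes _ = suc (count m P P?)
... | no  _ = count m P P?

-- a permutation of [0,N) viewed as a function ℕ → ℕ (values outside [0,N) irrelevant)
applyℕ : {N : ℕ} → (Fin N ↔ Fin N) → ℕ → ℕ
applyℕ {N} π x with x <? N
... | yes x<N = toℕ (Inverse.to π (fromℕ< x<N))
... | no  _   = N

hits : (n : ℕ) → (Fin (4 ^ n) ↔ Fin (4 ^ n)) → (i s : ℕ) → ℕ
hits n π i s = count (2 ^ n) (λ j → applyℕ π (i * 2 ^ n + j) < s)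
                               (λ j → applyℕ π (i * 2 ^ n + j) <? s)

-- ρ_s(π(X_i)) > 1/n, i.e. hits/s > 1/n, i.e. s < n · hits  (for s ≥ 1, n ≥ 1)
Dense : (n : ℕ) → (Fin (4 ^ n) ↔ Fin (4 ^ n)) → (i s : ℕ) → Set
Dense n π i s = s < n * hits n π i s

Dense? : (n : ℕ) → (π : Fin (4 ^ n) ↔ Fin (4 ^ n)) → (i s : ℕ) → Dec (Dense n π i s)
Dense? n π i s = s <? n * hits n π i s

-- ∃ s ∈ [1, 4^n] with ρ_s(π(X_i)) > 1/n, written s = t+1 with t < 4^n
Bad : (n : ℕ) → (Fin (4 ^ n) ↔ Fin (4 ^ n)) → (i : ℕ) → Set
Bad n π i = Σ ℕ (λ t → t < 4 ^ n × Dense n π i (suc t))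

Bad? : (n : ℕ) → (π : Fin (4 ^ n) ↔ Fin (4 ^ n)) → (i : ℕ) → Dec (Bad n π i)
Bad? n π i = anyUpTo? (λ t → Dense? n π i (suc t)) (4 ^ n)

numBad : (n : ℕ) → (Fin (4 ^ n) ↔ Fin (4 ^ n)) → ℕ
numBad n π = count (2 ^ n) (Bad n π) (Bad? n π)

-- Since π is injective, the blocks X_i together put at most s points below s, so for a
-- fixed threshold s = 2^k Markov's inequality leaves at most 2n blocks with
-- 2^k < 2n·|π(X_i) ∩ [0,2^k)|. A block that is dense at some s ≤ 4^n is such a block
-- at the dyadic scale s ≤ 2^k < 2s, and there are only 2n + 1 scales up to 4^n = 2^(2n).
module Submission where

open import Defs
open import Data.Nat using (ℕ; zero; suc; _+_; _*_; _^_; _≤_; _<_; _≤?_; _<?_; _≟_; z≤n; s≤s)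
open import Data.Nat.Properties
open import Data.Fin using (Fin)
open import Data.Fin.Properties using (toℕ-injective; fromℕ<-injective)
open import Data.Product using (Σ; _×_; _,_)
open import Data.Sum using (_⊎_; inj₁; inj₂)
open import Function.Bundles using (_↔_; Injection)
open import Function.Properties.Inverse using (↔⇒↣)
open import Relation.Nullary using (Dec; yes; no; ¬_)
open import Relation.Nullary.Negation using (contradiction)
open import Relation.Binary.PropositionalEquality using (_≡_; _≢_; refl; sym; trans; cong; subst)
open import Data.Nat.Solver using (module +-*-Solver)
open +-*-Solver using (solve; _:+_; _:*_; _:=_; con)

∑< : ℕ → (ℕ → ℕ) → ℕ
∑< zero    f = 0
∑< (suc m) f = ∑< m f + f m

∑<-mono-≤ : ∀ m {f g : ℕ → ℕ} → (∀ j → j < m → f j ≤ g j) → ∑< m f ≤ ∑< m g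
∑<-mono-≤ zero    f≤g = z≤n
∑<-mono-≤ (suc m) f≤g = +-mono-≤ (∑<-mono-≤ m (λ j j<m → f≤g j (m<n⇒m<1+n j<m))) (f≤g m ≤-refl)

∑<-cong-0 : ∀ m (f : ℕ → ℕ) → (∀ j → j < m → f j ≡ 0) → ∑< m f ≡ 0
∑<-cong-0 zero    f f≡0 = refl
∑<-cong-0 (suc m) f f≡0
  rewrite ∑<-cong-0 m f (λ j j<m → f≡0 j (m<n⇒m<1+n j<m)) | f≡0 m ≤-refl = refl

∑<-+ : ∀ m (f g : ℕ → ℕ) → ∑< m (λ j → f j + g j) ≡ ∑< m f + ∑< m g
∑<-+ zero    f g = refl
∑<-+ (suc m) f g rewrite ∑<-+ m f g =
  solve 4 (λ a b c d → (a :+ b) :+ (c :+ d) := (a :+ c) :+ (b :+ d)) refl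
    (∑< m f) (∑< m g) (f m) (g m)

∑<-*ˡ : ∀ m c (f : ℕ → ℕ) → ∑< m (λ j → c * f j) ≡ c * ∑< m f
∑<-*ˡ zero    c f = sym (*-zeroʳ c)
∑<-*ˡ (suc m) c f rewrite ∑<-*ˡ m c f = sym (*-distribˡ-+ c (∑< m f) (f m))

∑<-*ʳ : ∀ m c (f : ℕ → ℕ) → ∑< m (λ j → f j * c) ≡ ∑< m f * c
∑<-*ʳ zero    c f = refl
∑<-*ʳ (suc m) c f rewrite ∑<-*ʳ m c f = sym (*-distribʳ-+ c (∑< m f) (f m))

∑<-const : ∀ m c → ∑< m (λ _ → c) ≡ m * c
∑<-const zero    c = refl
∑<-const (suc m) c rewrite ∑<-const m c = +-comm (m * c) c

∑<-comm : ∀ m K (h : ℕ → ℕ → ℕ) → ∑< m (λ i → ∑< K (λ k → h k i)) ≡ ∑< K (λ k → ∑< m (h k))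
∑<-comm zero    K h = sym (∑<-cong-0 K _ (λ _ _ → refl))
∑<-comm (suc m) K h rewrite ∑<-comm m K h = sym (∑<-+ K (λ k → ∑< m (h k)) (λ k → h k m))

∑<-+-split : ∀ m n (f : ℕ → ℕ) → ∑< (m + n) f ≡ ∑< m f + ∑< n (λ j → f (m + j))
∑<-+-split m zero    f rewrite +-identityʳ m = sym (+-identityʳ _)
∑<-+-split m (suc n) f rewrite +-suc m n | ∑<-+-split m n f = +-assoc (∑< m f) _ _

∑<-*-blocks : ∀ a b (f : ℕ → ℕ) → ∑< (a * b) f ≡ ∑< a (λ i → ∑< b (λ j → f (i * b + j)))
∑<-*-blocks zero    b f = refl
∑<-*-blocks (suc a) b f rewrite +-comm b (a * b) | ∑<-+-split (a * b) b f | ∑<-*-blocks a b f = refl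

𝟙 : {P : Set} → Dec P → ℕ
𝟙 (yes _) = 1
𝟙 (no  _) = 0

count≡∑<𝟙 : ∀ m (P : ℕ → Set) (P? : (k : ℕ) → Dec (P k)) → count m P P? ≡ ∑< m (λ k → 𝟙 (P? k))
count≡∑<𝟙 zero    P P? = refl
count≡∑<𝟙 (suc m) P P? with P? m
... | yes _ = trans (cong suc (count≡∑<𝟙 m P P?)) (+-comm 1 _)
... | no  _ = trans (count≡∑<𝟙 m P P?) (sym (+-identityʳ _))

𝟙-reject : {P : Set} → ¬ P → (P? : Dec P) → 𝟙 P? ≡ 0
𝟙-reject ¬p (yes p) = contradiction p ¬p
𝟙-reject ¬p (no  _) = refl

𝟙-mono : {P Q : Set} → (P → Q) → (P? : Dec P) (Q? : Dec Q) → 𝟙 P? ≤ 𝟙 Q?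
𝟙-mono P⇒Q (no  _) Q?       = z≤n
𝟙-mono P⇒Q (yes _) (yes _)  = ≤-refl
𝟙-mono P⇒Q (yes p) (no ¬q)  = contradiction (P⇒Q p) ¬q

𝟙-⊎ : {P Q R : Set} → (P → Q ⊎ R) → (P? : Dec P) (Q? : Dec Q) (R? : Dec R) → 𝟙 P? ≤ 𝟙 Q? + 𝟙 R?
𝟙-⊎ P⇒Q⊎R (no  _) Q? R? = z≤n
𝟙-⊎ P⇒Q⊎R (yes p) Q? R? with P⇒Q⊎R p
... | inj₁ q = ≤-trans (𝟙-mono (λ _ → q) (yes p) Q?) (m≤m+n _ _)
... | inj₂ r = ≤-trans (𝟙-mono (λ _ → r) (yes p) R?) (m≤n+m _ _)

𝟙-≤-∑<-witnesses : {P : Set} (K : ℕ) {Q : ℕ → Set} (Q? : (k : ℕ) → Dec (Q k)) →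
                   (P → Σ ℕ λ k → k < K × Q k) → (P? : Dec P) → 𝟙 P? ≤ ∑< K (λ k → 𝟙 (Q? k))
𝟙-≤-∑<-witnesses K Q? witness (no  _) = z≤n
𝟙-≤-∑<-witnesses K Q? witness (yes p) with witness p
... | k , k<K , q = ≤-trans (𝟙-mono (λ _ → q) (yes p) (Q? k)) (term≤∑< K k<K)
  where
  term≤∑< : ∀ K {k} → k < K → 𝟙 (Q? k) ≤ ∑< K (λ k → 𝟙 (Q? k))
  term≤∑< (suc K) k<1+K with m≤n⇒m<n∨m≡n (≤-pred k<1+K)
  ... | inj₁ k<K  = ≤-trans (term≤∑< K k<K) (m≤m+n _ _)
  ... | inj₂ refl = m≤n+m _ _

markov : ∀ m a (f : ℕ → ℕ) → ∑< m (λ i → 𝟙 (a <? f i)) * a ≤ ∑< m f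
markov m a f = begin
    ∑< m (λ i → 𝟙 (a <? f i)) * a   ≡⟨ ∑<-*ʳ m a _ ⟨
    ∑< m (λ i → 𝟙 (a <? f i) * a)   ≤⟨ ∑<-mono-≤ m (λ i _ → 𝟙<*≤ (a <? f i)) ⟩
    ∑< m f                          ∎
  where
  open ≤-Reasoning
  𝟙<*≤ : ∀ {x} (a<x? : Dec (a < x)) → 𝟙 a<x? * a ≤ x
  𝟙<*≤ (yes a<x) = ≤-trans (≤-reflexive (+-identityʳ a)) (<⇒≤ a<x)
  𝟙<*≤ (no  _)   = z≤n

module _ {N : ℕ} {f : ℕ → ℕ} (f-inj : ∀ {x y} → x < N → y < N → f x ≡ f y → x ≡ y) where

  ∑<𝟙-fibre≤1 : ∀ {M} → M ≤ N → ∀ s → ∑< M (λ x → 𝟙 (f x ≟ s)) ≤ 1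
  ∑<𝟙-fibre≤1 {zero}  _   s = z≤n
  ∑<𝟙-fibre≤1 {suc M} M<N s with f M ≟ s
  ... | no  _   = ≤-trans (≤-reflexive (+-identityʳ _)) (∑<𝟙-fibre≤1 (<⇒≤ M<N) s)
  ... | yes fM≡s = ≤-reflexive (cong (_+ 1) (∑<-cong-0 M _ (λ j j<M → 𝟙-reject (fj≢s j<M) (f j ≟ s))))
    where
    fj≢s : ∀ {j} → j < M → f j ≢ s
    fj≢s j<M fj≡s = <⇒≢ j<M (f-inj (<-trans j<M M<N) M<N (trans fj≡s (sym fM≡s)))

  ∑<𝟙-below≤ : ∀ s → ∑< N (λ x → 𝟙 (f x <? s)) ≤ s
  ∑<𝟙-below≤ zero    = ≤-reflexive (∑<-cong-0 N _ (λ j _ → 𝟙-reject (λ ()) (f j <? 0)))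
  ∑<𝟙-below≤ (suc s) = begin
      ∑< N (λ x → 𝟙 (f x <? suc s))                    ≤⟨ ∑<-mono-≤ N (λ x _ → split x) ⟩
      ∑< N (λ x → 𝟙 (f x <? s) + 𝟙 (f x ≟ s))          ≡⟨ ∑<-+ N _ _ ⟩
      ∑< N (λ x → 𝟙 (f x <? s)) + ∑< N (λ x → 𝟙 (f x ≟ s)) ≤⟨ +-mono-≤ (∑<𝟙-below≤ s) (∑<𝟙-fibre≤1 ≤-refl s) ⟩
      s + 1                                             ≡⟨ +-comm s 1 ⟩
      suc s                                             ∎
    where
    open ≤-Reasoning
    split : ∀ x → 𝟙 (f x <? suc s) ≤ 𝟙 (f x <? s) + 𝟙 (f x ≟ s)
    split x = 𝟙-⊎ m<1+n⇒m<n∨m≡n (f x <? suc s) (f x <? s) (f x ≟ s)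

applyℕ-injective : ∀ {N} (π : Fin N ↔ Fin N) {x y} → x < N → y < N → applyℕ π x ≡ applyℕ π y → x ≡ y
applyℕ-injective {N} π {x} {y} x<N y<N πx≡πy with x <? N | y <? N
... | no x≮N | _       = contradiction x<N x≮N
... | yes _  | no y≮N  = contradiction y<N y≮N
... | yes p  | yes q   = fromℕ<-injective x y p q (Injection.injective (↔⇒↣ π) (toℕ-injective πx≡πy))

4^n≡2^n*2^n : ∀ n → 4 ^ n ≡ 2 ^ n * 2 ^ n
4^n≡2^n*2^n n = trans (^-*-assoc 2 2 n) (trans (cong (λ m → 2 ^ (n + m)) (+-identityʳ n)) (^-distribˡ-+-* 2 n n))

dyadic-scale : ∀ K m → 1 ≤ m → m ≤ 2 ^ K → Σ ℕ λ k → k ≤ K × m ≤ 2 ^ k × 2 ^ k < 2 * m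
dyadic-scale zero    (suc zero)    _ _                = 0 , z≤n , ≤-refl , s≤s (s≤s z≤n)
dyadic-scale zero    (suc (suc m)) _ (s≤s ())
dyadic-scale (suc K) m 1≤m m≤2^[1+K] with m ≤? 2 ^ K
... | no  m≰2^K = suc K , ≤-refl , m≤2^[1+K] , *-monoʳ-< 2 (≰⇒> m≰2^K)
... | yes m≤2^K with dyadic-scale K m 1≤m m≤2^K
...   | k , k≤K , m≤2^k , 2^k<2m = k , m≤n⇒m≤1+n k≤K , m≤2^k , 2^k<2m

module _ (n : ℕ) (π : Fin (4 ^ n) ↔ Fin (4 ^ n)) where

  hits≡∑<𝟙 : ∀ i s → hits n π i s ≡ ∑< (2 ^ n) (λ j → 𝟙 (applyℕ π (i * 2 ^ n + j) <? s))
  hits≡∑<𝟙 i s = count≡∑<𝟙 (2 ^ n) _ _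

  hits-mono : ∀ i {s s′} → s ≤ s′ → hits n π i s ≤ hits n π i s′
  hits-mono i {s} {s′} s≤s′ rewrite hits≡∑<𝟙 i s | hits≡∑<𝟙 i s′ =
    ∑<-mono-≤ (2 ^ n) (λ j _ → 𝟙-mono (λ x<s → <-≤-trans x<s s≤s′) (_ <? s) (_ <? s′))

  ∑<-hits≤ : ∀ s → ∑< (2 ^ n) (λ i → hits n π i s) ≤ s
  ∑<-hits≤ s = begin
      ∑< (2 ^ n) (λ i → hits n π i s)
        ≤⟨ ∑<-mono-≤ (2 ^ n) (λ i _ → ≤-reflexive (hits≡∑<𝟙 i s)) ⟩
      ∑< (2 ^ n) (λ i → ∑< (2 ^ n) (λ j → 𝟙 (applyℕ π (i * 2 ^ n + j) <? s)))
        ≡⟨ ∑<-*-blocks (2 ^ n) (2 ^ n) (λ x → 𝟙 (applyℕ π x <? s)) ⟨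
      ∑< (2 ^ n * 2 ^ n) (λ x → 𝟙 (applyℕ π x <? s))
        ≤⟨ ∑<𝟙-below≤ inj s ⟩
      s ∎
    where
    open ≤-Reasoning
    inj : ∀ {x y} → x < 2 ^ n * 2 ^ n → y < 2 ^ n * 2 ^ n → applyℕ π x ≡ applyℕ π y → x ≡ y
    inj x< y< = applyℕ-injective π (subst (_ <_) (sym (4^n≡2^n*2^n n)) x<) (subst (_ <_) (sym (4^n≡2^n*2^n n)) y<)

  Heavy : ℕ → ℕ → Set
  Heavy k i = 2 ^ k < 2 * n * hits n π i (2 ^ k)

  Heavy? : ∀ k i → Dec (Heavy k i)
  Heavy? k i = 2 ^ k <? 2 * n * hits n π i (2 ^ k)

  ∑<𝟙-Heavy≤ : ∀ k → ∑< (2 ^ n) (λ i → 𝟙 (Heavy? k i)) ≤ 2 * n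
  ∑<𝟙-Heavy≤ k = *-cancelʳ-≤ _ _ (2 ^ k) {{m^n≢0 2 k}} (begin
      ∑< (2 ^ n) (λ i → 𝟙 (Heavy? k i)) * 2 ^ k     ≤⟨ markov (2 ^ n) (2 ^ k) (λ i → 2 * n * hits n π i (2 ^ k)) ⟩
      ∑< (2 ^ n) (λ i → 2 * n * hits n π i (2 ^ k)) ≡⟨ ∑<-*ˡ (2 ^ n) (2 * n) _ ⟩
      2 * n * ∑< (2 ^ n) (λ i → hits n π i (2 ^ k)) ≤⟨ *-monoʳ-≤ (2 * n) (∑<-hits≤ (2 ^ k)) ⟩
      2 * n * 2 ^ k                                 ∎)
    where open ≤-Reasoning

  Bad⇒Heavy : ∀ i → Bad n π i → Σ ℕ λ k → k < suc (2 * n) × Heavy k i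
  Bad⇒Heavy i (t , t<4^n , dense)
    with dyadic-scale (2 * n) (suc t) (s≤s z≤n) (subst (suc t ≤_) (^-*-assoc 2 2 n) t<4^n)
  ... | k , k≤2n , 1+t≤2^k , 2^k<2[1+t] = k , s≤s k≤2n , (begin-strict
      2 ^ k                             <⟨ 2^k<2[1+t] ⟩
      2 * suc t                         ≤⟨ *-monoʳ-≤ 2 (<⇒≤ dense) ⟩
      2 * (n * hits n π i (suc t))      ≤⟨ *-monoʳ-≤ 2 (*-monoʳ-≤ n (hits-mono i 1+t≤2^k)) ⟩
      2 * (n * hits n π i (2 ^ k))      ≡⟨ *-assoc 2 n _ ⟨
      2 * n * hits n π i (2 ^ k)        ∎)
    where open ≤-Reasoning

  numBad≤ : numBad n π ≤ suc (2 * n) * (2 * n)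
  numBad≤ = begin
      numBad n π
        ≡⟨ count≡∑<𝟙 (2 ^ n) _ _ ⟩
      ∑< (2 ^ n) (λ i → 𝟙 (Bad? n π i))
        ≤⟨ ∑<-mono-≤ (2 ^ n) (λ i _ → 𝟙-≤-∑<-witnesses (suc (2 * n)) (λ k → Heavy? k i) (Bad⇒Heavy i) (Bad? n π i)) ⟩
      ∑< (2 ^ n) (λ i → ∑< (suc (2 * n)) (λ k → 𝟙 (Heavy? k i)))
        ≡⟨ ∑<-comm (2 ^ n) (suc (2 * n)) (λ k i → 𝟙 (Heavy? k i)) ⟩
      ∑< (suc (2 * n)) (λ k → ∑< (2 ^ n) (λ i → 𝟙 (Heavy? k i)))
        ≤⟨ ∑<-mono-≤ (suc (2 * n)) (λ k _ → ∑<𝟙-Heavy≤ k) ⟩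
      ∑< (suc (2 * n)) (λ _ → 2 * n)
        ≡⟨ ∑<-const (suc (2 * n)) (2 * n) ⟩
      suc (2 * n) * (2 * n) ∎
    where open ≤-Reasoning

lemma5 : Σ ℕ (λ c → (n : ℕ) → 1 ≤ n → (π : Fin (4 ^ n) ↔ Fin (4 ^ n)) →
    numBad n π ≤ c * (n * n))
lemma5 = 6 , λ n 1≤n π → begin
    numBad n π               ≤⟨ numBad≤ n π ⟩
    suc (2 * n) * (2 * n)    ≤⟨ *-monoˡ-≤ (2 * n) (+-monoˡ-≤ (2 * n) 1≤n) ⟩
    (n + 2 * n) * (2 * n)    ≡⟨ solve 1 (λ a → (a :+ con 2 :* a) :* (con 2 :* a) := con 6 :* (a :* a)) refl n ⟩
    6 * (n * n)              ∎
  where open ≤-Reasoning
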